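{- Let $k$ be a positive integer and let $D$ be a digraph of order $n\ge k$ with no isolated vertex. Then $\gamma_t(D)\le\gamma_{trk}(D)\le k\gamma_t(D)$. Further: (a) $\gamma_t(D)=\gamma_{trk}(D)$ if and only if there exists a $\gamma_t(D)$-set $X$ which can be partitioned into $k$ nonempty subsets $X_1,\dots,X_k$ such that $V(D)\setminus X\subseteq N^+(X_i)$ for each $i\in\{1,\dots,k\}$; (b) $\gamma_{trk}(D)=k\gamma_t(D)$ if and only if there exists a $\gamma_{trk}(D)$-function $f$ such that for each $v\in V(D)$, either $f(v)=\{1,\dots,k\}$ or $f(v)=\emptyset$.
   Context: All digraphs are finite, without loops or multiple arcs (pairs of opposite arcs are allowed). $N^+(v)$, $N^-(v)$ denote out- and in-neighborhoods, $N^+[v]=N^+(v)\cup\{v\}$, and for $X\subseteq V(D)$, $N^+(X)=\bigcup_{v\in X}N^+(v)$, $N^+[X]=\bigcup_{v\in X}N^+[v]$. A vertex is isolated if it has no in- or out-neighbors. A dominating set is $S\subseteq V(D)$ with $N^+[S]=V(D)$; a total dominating set is a dominating set $S$ such that the induced subdigraph $D[S]$ has no isolated vertex; $\gamma_t(D)$ is the minimum cardinality of a total dominating set, and a total dominating set of that cardinality is a $\gamma_t(D)$-set. A $k$RDF on $D$ is a function $f:V(D)\to\mathcal{P}(\{1,\dots,k\})$ such that every $v$ with $f(v)=\emptyset$ satisfies $\bigcup_{u\in N^-(v)}f(u)=\{1,\dots,k\}$; its weight is $\omega(f)=\sum_v|f(v)|$. For $D$ with no isolated vertex, a T$k$RDF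 is a $k$RDF $f$ such that the subdigraph induced by $\{v:f(v)\ne\emptyset\}$ has no isolated vertex; $\gamma_{trk}(D)$ is the minimum weight of a T$k$RDF, and a T$k$RDF of that weight is a $\gamma_{trk}(D)$-function. -}

module Defs where

open import Data.Nat using (ℕ; _*_)
open import Data.Bool using (Bool; true; false)
open import Data.Fin using (Fin)
open import Data.Fin.Subset using (Subset; _∈_; _∉_; ∣_∣; ⊥; ⊤; Nonempty)
open import Data.Vec using (sum; tabulate)
open import Data.Product using (Σ; ∃; ∃-syntax; _×_; _,_)
open import Data.Sum using (_⊎_)
open import Relation.Nullary using (¬_)
open import Relation.Binary.PropositionalEquality using (_≡_; _≢_)

-- A digraph on vertex set Fin n: arc relation (decidable, as Bool),
-- no loops. Pairs of opposite arcs are allowed; multiple arcs cannot occur.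
record Digraph (n : ℕ) : Set where
  field
    arc     : Fin n → Fin n → Bool
    noLoops : ∀ v → arc v v ≡ false

module _ {n : ℕ} (D : Digraph n) where
  open Digraph D

  Arc : Fin n → Fin n → Set
  Arc u v = arc u v ≡ true

  InOutNbhd : Subset n → Fin n → Set
  InOutNbhd X v = ∃[ u ] (u ∈ X × Arc u v)

  NoIsolatedVertex : Set
  NoIsolatedVertex = ∀ v → ∃[ u ] (Arc v u ⊎ Arc u v)

  IsDominating : Subset n → Set
  IsDominating S = ∀ v → v ∈ S ⊎ InOutNbhd S v

  InducedNoIsolated : Subset n → Set
  InducedNoIsolated S = ∀ v → v ∈ S → ∃[ u ] (u ∈ S × (Arc v u ⊎ Arc u v))

  IsTDS : Subset n → Set
  IsTDS S = IsDominating S × InducedNoIsolated S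

  IsGammaTSet : Subset n → Set
  IsGammaTSet S = IsTDS S × (∀ T → IsTDS T → ∣ S ∣ Data.Nat.≤ ∣ T ∣)

  IsGammaT : ℕ → Set
  IsGammaT g = ∃[ S ] (IsGammaTSet S × ∣ S ∣ ≡ g)

  module _ (k : ℕ) where
    weight : (Fin n → Subset k) → ℕ
    weight f = sum (tabulate (λ v → ∣ f v ∣))

    IsKRDF : (Fin n → Subset k) → Set
    IsKRDF f = ∀ v → f v ≡ ⊥ → ∀ (i : Fin k) → ∃[ u ] (Arc u v × i ∈ f u)

    IsTKRDF : (Fin n → Subset k) → Set
    IsTKRDF f = IsKRDF f ×
      (∀ v → f v ≢ ⊥ → ∃[ u ] (f u ≢ ⊥ × (Arc v u ⊎ Arc u v)))

    IsGammaTRkFunction : (Fin n → Subset k) → Set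
    IsGammaTRkFunction f = IsTKRDF f × (∀ g → IsTKRDF g → weight f Data.Nat.≤ weight g)

    IsGammaTRk : ℕ → Set
    IsGammaTRk t = ∃[ f ] (IsGammaTRkFunction f × weight f ≡ t)

    GoodPartition : Subset n → (Fin k → Subset n) → Set
    GoodPartition X Xs =
      (∀ i → Nonempty (Xs i)) ×
      (∀ i j → i ≢ j → ∀ v → v ∈ Xs i → v ∉ Xs j) ×
      (∀ v → (v ∈ X → ∃[ i ] (v ∈ Xs i)) × (∀ i → v ∈ Xs i → v ∈ X)) ×
      (∀ i v → v ∉ X → InOutNbhd (Xs i) v)

{-# OPTIONS --safe #-}
-- The support of a TkRDF f is a total dominating set with at most weight f elements, and a
-- total dominating set S carries the TkRDF that is {1,…,k} on S and ∅ elsewhere, of weight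
-- k|S|; this gives both bounds.  If γ_t = γ_trk, a minimum TkRDF attains the first bound, so
-- it is singleton-valued on its support, and colouring each vertex by its singleton splits the
-- support into the required k parts (when the support is all of V, any k nonempty parts do,
-- which is where n ≥ k enters).  Conversely such a partition gives the TkRDF
-- v ↦ {i | v ∈ Xᵢ}, of weight |X|.  For (b), a function with values ∅ and {1,…,k} has weight
-- k times the size of its support, which is a total dominating set.
module Submission where

open import Defs
open import Data.Bool using (Bool; true; false; if_then_else_)
open import Data.Fin using (Fin; zero; suc; toℕ; fromℕ<; inject≤; _≟_)
open import Data.Fin.Properties using (toℕ-injective; toℕ-fromℕ<; toℕ-inject≤; toℕ<n; any?)
open import Data.Fin.Subset using (Subset; ⊥; ⊤; _∈_; _∉_; _⊆_; ∣_∣; Nonempty; ⁅_⁆; _-_)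
open import Data.Fin.Subset.Properties
  using (_∈?_; nonempty?; Empty-unique; ∉⊥; ∈⊤; ∣⊤∣≡n; ∣⊥∣≡0; ∣⁅x⁆∣≡1; x∈⁅x⁆; x∈⁅y⁆⇒x≡y;
         p⊆q⇒∣p∣≤∣q∣; x∈p∧x≢y⇒x∈p-y; x∈p⇒∣p-x∣<∣p∣)
open import Data.Nat using (ℕ; zero; suc; _+_; _*_; _≤_; _≥_; z≤n; NonZero; >-nonZero; >-nonZero⁻¹)
open import Data.Nat.DivMod using (_mod_; m<n⇒m%n≡m)
open import Data.Nat.Properties
  using (≤-refl; ≤-trans; ≤-antisym; ≤-reflexive; ≤-<-trans; ≤⇒≯; +-mono-≤; +-monoˡ-≤; +-monoʳ-≤; +-cancelˡ-≤; +-cancelʳ-≤;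
         *-zeroʳ; *-identityʳ; *-distribˡ-+; *-monoʳ-≤; module ≤-Reasoning)
open import Data.Product using (∃-syntax; _×_; _,_; proj₁; proj₂)
open import Data.Sum using (_⊎_; inj₁; inj₂)
open import Data.Vec using (_∷_; []; lookup; tabulate; sum)
open import Data.Vec.Properties using (lookup∘tabulate; tabulate-cong; []=⇒lookup; lookup⇒[]=)
open import Function.Base using (_∘_)
open import Function.Bundles using (_⇔_; mk⇔)
open import Level using (Level)
open import Relation.Nullary using (yes; no; does; contradiction; ¬?)
open import Relation.Nullary.Decidable using (dec-true; dec-false; _×-dec_)
open import Relation.Unary using (Pred; Decidable)
open import Relation.Binary.PropositionalEquality
  using (_≡_; _≢_; refl; sym; trans; cong; subst; _≗_; module ≡-Reasoning)

private variable
  ℓ : Level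
  k n : ℕ

sum-tabulate-mono : {f g : Fin n → ℕ} → (∀ v → f v ≤ g v) → sum (tabulate f) ≤ sum (tabulate g)
sum-tabulate-mono {zero}  f≤g = z≤n
sum-tabulate-mono {suc n} f≤g = +-mono-≤ (f≤g zero) (sum-tabulate-mono (f≤g ∘ suc))

*-distribˡ-sum-tabulate : ∀ c (f : Fin n → ℕ) → c * sum (tabulate f) ≡ sum (tabulate (λ v → c * f v))
*-distribˡ-sum-tabulate {zero}  c f = *-zeroʳ c
*-distribˡ-sum-tabulate {suc n} c f =
  trans (*-distribˡ-+ c (f zero) _) (cong (c * f zero +_) (*-distribˡ-sum-tabulate c (f ∘ suc)))

sum-tabulate-rigid : {f g : Fin n → ℕ} → (∀ v → f v ≤ g v) →
                     sum (tabulate g) ≤ sum (tabulate f) → ∀ v → g v ≤ f v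
sum-tabulate-rigid {suc n} {f} {g} f≤g Σg≤Σf = go
  where
  Σf′≤Σg′ : sum (tabulate (f ∘ suc)) ≤ sum (tabulate (g ∘ suc))
  Σf′≤Σg′ = sum-tabulate-mono (f≤g ∘ suc)
  go : ∀ v → g v ≤ f v
  go zero    = +-cancelʳ-≤ _ (g zero) (f zero) (≤-trans Σg≤Σf (+-monoʳ-≤ (f zero) Σf′≤Σg′))
  go (suc v) = sum-tabulate-rigid (f≤g ∘ suc)
                 (+-cancelˡ-≤ (g zero) _ _ (≤-trans Σg≤Σf (+-monoˡ-≤ _ (f≤g zero)))) v

indicator : Bool → ℕ
indicator b = if b then 1 else 0

∣p∣≡sum-indicator : (p : Subset n) → ∣ p ∣ ≡ sum (tabulate (indicator ∘ lookup p))
∣p∣≡sum-indicator []          = refl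
∣p∣≡sum-indicator (true ∷ p)  = cong suc (∣p∣≡sum-indicator p)
∣p∣≡sum-indicator (false ∷ p) = ∣p∣≡sum-indicator p

setOf : {P : Pred (Fin n) ℓ} → Decidable P → Subset n
setOf P? = tabulate (does ∘ P?)

module _ {P : Pred (Fin n) ℓ} (P? : Decidable P) where

  lookup-setOf : ∀ v → lookup (setOf P?) v ≡ does (P? v)
  lookup-setOf = lookup∘tabulate (does ∘ P?)

  ∈-setOf⁺ : ∀ {v} → P v → v ∈ setOf P?
  ∈-setOf⁺ {v} pv = lookup⇒[]= v _ (trans (lookup-setOf v) (dec-true (P? v) pv))

  ∈-setOf⁻ : ∀ {v} → v ∈ setOf P? → P v
  ∈-setOf⁻ {v} v∈ with P? v
  ... | yes pv = pv
  ... | no ¬pv =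
    contradiction (trans (sym ([]=⇒lookup v∈)) (trans (lookup-setOf v) (dec-false (P? v) ¬pv))) λ ()

x∈p⇒⁅x⁆⊆p : ∀ {p : Subset n} {x} → x ∈ p → ⁅ x ⁆ ⊆ p
x∈p⇒⁅x⁆⊆p {p = p} x∈p y∈⁅x⁆ = subst (_∈ p) (sym (x∈⁅y⁆⇒x≡y _ y∈⁅x⁆)) x∈p

x∈p⇒1≤∣p∣ : ∀ {p : Subset n} {x} → x ∈ p → 1 ≤ ∣ p ∣
x∈p⇒1≤∣p∣ {p = p} {x} x∈p = subst (_≤ ∣ p ∣) (∣⁅x⁆∣≡1 x) (p⊆q⇒∣p∣≤∣q∣ (x∈p⇒⁅x⁆⊆p x∈p))

∣p∣≤1⇒∈-unique : ∀ {p : Subset n} {x y} → ∣ p ∣ ≤ 1 → x ∈ p → y ∈ p → x ≡ y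
∣p∣≤1⇒∈-unique {x = x} {y} ∣p∣≤1 x∈p y∈p with x ≟ y
... | yes x≡y = x≡y
... | no x≢y  = contradiction
  (≤-<-trans (x∈p⇒1≤∣p∣ (x∈p∧x≢y⇒x∈p-y y∈p (x≢y ∘ sym))) (x∈p⇒∣p-x∣<∣p∣ x∈p)) (≤⇒≯ ∣p∣≤1)

Nonempty⇒≢⊥ : {p : Subset n} → Nonempty p → p ≢ ⊥
Nonempty⇒≢⊥ (_ , x∈p) refl = ∉⊥ x∈p

≢⊥⇒Nonempty : {p : Subset n} → p ≢ ⊥ → Nonempty p
≢⊥⇒Nonempty {p = p} p≢⊥ with nonempty? p
... | yes ne = ne
... | no ¬ne = contradiction (Empty-unique ¬ne) p≢⊥

module _ .{{_ : NonZero k}} where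

  someElement : Fin k
  someElement = fromℕ< (>-nonZero⁻¹ k)

  pick : Subset k → Fin k
  pick p with nonempty? p
  ... | yes (i , _) = i
  ... | no _        = someElement

  pick-unique : ∀ {p i} → ∣ p ∣ ≤ 1 → i ∈ p → pick p ≡ i
  pick-unique {p} ∣p∣≤1 i∈p with nonempty? p
  ... | yes (j , j∈p) = ∣p∣≤1⇒∈-unique ∣p∣≤1 j∈p i∈p
  ... | no ¬ne        = contradiction (_ , i∈p) ¬ne

  toℕ-mod : (i : Fin k) → toℕ i mod k ≡ i
  toℕ-mod i = toℕ-injective (trans (toℕ-fromℕ< _) (m<n⇒m%n≡m (toℕ<n i)))

module _ {n : ℕ} (D : Digraph n) {k : ℕ} where

  support : (Fin n → Subset k) → Subset n
  support f = setOf (λ v → nonempty? (f v))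

  ∈-support⁺ : ∀ {f v} → Nonempty (f v) → v ∈ support f
  ∈-support⁺ {f} = ∈-setOf⁺ (λ v → nonempty? (f v))

  ∈-support⁻ : ∀ {f v} → v ∈ support f → Nonempty (f v)
  ∈-support⁻ {f} = ∈-setOf⁻ (λ v → nonempty? (f v))

  indicator-support≤∣f∣ : ∀ f v → indicator (lookup (support f) v) ≤ ∣ f v ∣
  indicator-support≤∣f∣ f v rewrite lookup-setOf (λ v → nonempty? (f v)) v with nonempty? (f v)
  ... | yes (_ , i∈fv) = x∈p⇒1≤∣p∣ i∈fv
  ... | no _           = z≤n

  ∣support∣≤weight : ∀ f → ∣ support f ∣ ≤ weight D k f
  ∣support∣≤weight f = begin
    ∣ support f ∣                                    ≡⟨ ∣p∣≡sum-indicator (support f) ⟩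
    sum (tabulate (indicator ∘ lookup (support f)))  ≤⟨ sum-tabulate-mono (indicator-support≤∣f∣ f) ⟩
    weight D k f                                     ∎
    where open ≤-Reasoning

  weight≤∣support∣⇒∣f∣≤1 : ∀ {f} → weight D k f ≤ ∣ support f ∣ → ∀ v → ∣ f v ∣ ≤ 1
  weight≤∣support∣⇒∣f∣≤1 {f} wf≤∣X∣ v = ≤-trans
    (sum-tabulate-rigid (indicator-support≤∣f∣ f) (≤-trans wf≤∣X∣ (≤-reflexive (∣p∣≡sum-indicator (support f)))) v)
    (indicator≤1 (lookup (support f) v))
    where
    indicator≤1 : ∀ b → indicator b ≤ 1
    indicator≤1 true  = ≤-refl
    indicator≤1 false = z≤n

  support-isTDS : .{{_ : NonZero k}} → ∀ {f} → IsTKRDF D k f → IsTDS D (support f)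
  support-isTDS {f} (f-kRDF , f-total) = dominating , induced
    where
    dominating : IsDominating D (support f)
    dominating v with nonempty? (f v)
    ... | yes ne = inj₁ (∈-support⁺ ne)
    ... | no ¬ne with f-kRDF v (Empty-unique ¬ne) someElement
    ...   | u , u→v , i∈fu = inj₂ (u , ∈-support⁺ (_ , i∈fu) , u→v)
    induced : InducedNoIsolated D (support f)
    induced v v∈ with f-total v (Nonempty⇒≢⊥ (∈-support⁻ v∈))
    ... | u , fu≢⊥ , arc = u , ∈-support⁺ (≢⊥⇒Nonempty fu≢⊥) , arc

  fullOn : Subset n → Fin n → Subset k
  fullOn S v = if lookup S v then ⊤ else ⊥

  ∣if⊤else⊥∣ : ∀ b → ∣ (if b then ⊤ {k} else ⊥) ∣ ≡ k * indicator b
  ∣if⊤else⊥∣ true  = trans (∣⊤∣≡n k) (sym (*-identityʳ k))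
  ∣if⊤else⊥∣ false = trans (∣⊥∣≡0 k) (sym (*-zeroʳ k))

  weight-fullOn : ∀ S → weight D k (fullOn S) ≡ k * ∣ S ∣
  weight-fullOn S = begin
    weight D k (fullOn S)                                ≡⟨ cong sum (tabulate-cong (∣if⊤else⊥∣ ∘ lookup S)) ⟩
    sum (tabulate (λ v → k * indicator (lookup S v)))    ≡⟨ *-distribˡ-sum-tabulate k (indicator ∘ lookup S) ⟨
    k * sum (tabulate (indicator ∘ lookup S))            ≡⟨ cong (k *_) (∣p∣≡sum-indicator S) ⟨
    k * ∣ S ∣                                            ∎
    where open ≡-Reasoning

  fullOn-⊤⊥-valued : ∀ S v → fullOn S v ≡ ⊤ ⊎ fullOn S v ≡ ⊥
  fullOn-⊤⊥-valued S v with lookup S v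
  ... | true  = inj₁ refl
  ... | false = inj₂ refl

  ∈-fullOn : ∀ {S v i} → v ∈ S → i ∈ fullOn S v
  ∈-fullOn v∈S rewrite []=⇒lookup v∈S = ∈⊤

  fullOn-≢⊥⁺ : .{{_ : NonZero k}} → ∀ {S v} → v ∈ S → fullOn S v ≢ ⊥
  fullOn-≢⊥⁺ v∈S = Nonempty⇒≢⊥ (someElement , ∈-fullOn v∈S)

  fullOn-≢⊥⁻ : ∀ {S v} → fullOn S v ≢ ⊥ → v ∈ S
  fullOn-≢⊥⁻ {S} {v} fv≢⊥ with lookup S v in eq
  ... | true  = lookup⇒[]= v S eq
  ... | false = contradiction refl fv≢⊥

  fullOn-isTKRDF : .{{_ : NonZero k}} → ∀ {S} → IsTDS D S → IsTKRDF D k (fullOn S)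
  fullOn-isTKRDF {S} (dominating , induced) = kRDF , total
    where
    kRDF : IsKRDF D k (fullOn S)
    kRDF v fv≡⊥ i with dominating v
    ... | inj₁ v∈S             = contradiction fv≡⊥ (fullOn-≢⊥⁺ v∈S)
    ... | inj₂ (u , u∈S , u→v) = u , u→v , ∈-fullOn u∈S
    total : ∀ v → fullOn S v ≢ ⊥ → ∃[ u ] (fullOn S u ≢ ⊥ × (Arc D v u ⊎ Arc D u v))
    total v fv≢⊥ with induced v (fullOn-≢⊥⁻ fv≢⊥)
    ... | u , u∈S , arc = u , fullOn-≢⊥⁺ u∈S , arc

  ⊤⊥-valued⇒≗fullOn-support : .{{_ : NonZero k}} → ∀ {f} →
    (∀ v → f v ≡ ⊤ ⊎ f v ≡ ⊥) → f ≗ fullOn (support f)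
  ⊤⊥-valued⇒≗fullOn-support {f} ⊤⊥-valued v
    rewrite lookup-setOf (λ v → nonempty? (f v)) v with ⊤⊥-valued v
  ... | inj₁ fv≡⊤ rewrite fv≡⊤ | dec-true  (nonempty? (⊤ {k})) (someElement , ∈⊤) = refl
  ... | inj₂ fv≡⊥ rewrite fv≡⊥ | dec-false (nonempty? (⊥ {k})) (∉⊥ ∘ proj₂)      = refl

  blocksContaining : (Fin k → Subset n) → Fin n → Subset k
  blocksContaining Xs v = setOf (λ i → v ∈? Xs i)

  module _ {X : Subset n} {Xs : Fin k → Subset n} (partition : GoodPartition D k X Xs) where

    private
      disjoint : ∀ i j → i ≢ j → ∀ v → v ∈ Xs i → v ∉ Xs j
      disjoint = proj₁ (proj₂ partition)
      covering : ∀ v → (v ∈ X → ∃[ i ] (v ∈ Xs i)) × (∀ i → v ∈ Xs i → v ∈ X)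
      covering = proj₁ (proj₂ (proj₂ partition))
      dominates : ∀ i v → v ∉ X → InOutNbhd D (Xs i) v
      dominates = proj₂ (proj₂ (proj₂ partition))

    ∈-blocksContaining⁺ : ∀ {i v} → v ∈ Xs i → i ∈ blocksContaining Xs v
    ∈-blocksContaining⁺ {v = v} = ∈-setOf⁺ (λ i → v ∈? Xs i)

    ∈-blocksContaining⁻ : ∀ {i v} → i ∈ blocksContaining Xs v → v ∈ Xs i
    ∈-blocksContaining⁻ {v = v} = ∈-setOf⁻ (λ i → v ∈? Xs i)

    blocksContaining-≢⊥⁺ : ∀ {v} → v ∈ X → blocksContaining Xs v ≢ ⊥
    blocksContaining-≢⊥⁺ {v} v∈X =
      Nonempty⇒≢⊥ (_ , ∈-blocksContaining⁺ (proj₂ (proj₁ (covering v) v∈X)))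

    blocksContaining-≢⊥⁻ : ∀ {v} → blocksContaining Xs v ≢ ⊥ → v ∈ X
    blocksContaining-≢⊥⁻ {v} ≢⊥ with ≢⊥⇒Nonempty ≢⊥
    ... | i , i∈ = proj₂ (covering v) i (∈-blocksContaining⁻ i∈)

    blocksContaining⊆⁅i⁆ : ∀ {i v} → v ∈ Xs i → blocksContaining Xs v ⊆ ⁅ i ⁆
    blocksContaining⊆⁅i⁆ {i} {v} v∈Xᵢ {j} j∈ with j ≟ i
    ... | yes refl = x∈⁅x⁆ i
    ... | no j≢i   = contradiction v∈Xᵢ (disjoint j i j≢i v (∈-blocksContaining⁻ j∈))

    blocksContaining⊆⊥ : ∀ {v} → v ∉ X → blocksContaining Xs v ⊆ ⊥
    blocksContaining⊆⊥ {v} v∉X {j} j∈ = contradiction (proj₂ (covering v) j (∈-blocksContaining⁻ j∈)) v∉X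

    ∣blocksContaining∣≤indicator : ∀ v → ∣ blocksContaining Xs v ∣ ≤ indicator (lookup X v)
    ∣blocksContaining∣≤indicator v with lookup X v in eq
    ... | true with proj₁ (covering v) (lookup⇒[]= v X eq)
    ...   | i , v∈Xᵢ = subst (∣ blocksContaining Xs v ∣ ≤_) (∣⁅x⁆∣≡1 i) (p⊆q⇒∣p∣≤∣q∣ (blocksContaining⊆⁅i⁆ v∈Xᵢ))
    ∣blocksContaining∣≤indicator v | false = subst (∣ blocksContaining Xs v ∣ ≤_) (∣⊥∣≡0 k)
      (p⊆q⇒∣p∣≤∣q∣ (blocksContaining⊆⊥ λ v∈X → contradiction (trans (sym ([]=⇒lookup v∈X)) eq) λ ()))

    weight-blocksContaining : weight D k (blocksContaining Xs) ≤ ∣ X ∣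
    weight-blocksContaining = begin
      weight D k (blocksContaining Xs)       ≤⟨ sum-tabulate-mono ∣blocksContaining∣≤indicator ⟩
      sum (tabulate (indicator ∘ lookup X))  ≡⟨ ∣p∣≡sum-indicator X ⟨
      ∣ X ∣                                  ∎
      where open ≤-Reasoning

    blocksContaining-isTKRDF : IsTDS D X → IsTKRDF D k (blocksContaining Xs)
    blocksContaining-isTKRDF (_ , induced) = kRDF , total
      where
      kRDF : IsKRDF D k (blocksContaining Xs)
      kRDF v ≡⊥ i with dominates i v (λ v∈X → blocksContaining-≢⊥⁺ v∈X ≡⊥)
      ... | u , u∈Xᵢ , u→v = u , u→v , ∈-blocksContaining⁺ u∈Xᵢ
      total : ∀ v → blocksContaining Xs v ≢ ⊥ →
              ∃[ u ] (blocksContaining Xs u ≢ ⊥ × (Arc D v u ⊎ Arc D u v))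
      total v ≢⊥ with induced v (blocksContaining-≢⊥⁻ ≢⊥)
      ... | u , u∈X , arc = u , blocksContaining-≢⊥⁺ u∈X , arc

  colourClass : Subset n → (Fin n → Fin k) → Fin k → Subset n
  colourClass X c i = setOf (λ v → v ∈? X ×-dec c v ≟ i)

  colourClasses-good : ∀ X c → (∀ i → ∃[ v ] (v ∈ X × c v ≡ i)) →
    (∀ i v → v ∉ X → ∃[ u ] (u ∈ X × c u ≡ i × Arc D u v)) →
    GoodPartition D k X (colourClass X c)
  colourClasses-good X c surjective dominated =
    nonempty , disjoint , (λ v → covered , λ i → proj₁ ∘ ∈⁻) , dominates
    where
    ∈⁺ : ∀ {i v} → v ∈ X × c v ≡ i → v ∈ colourClass X c i
    ∈⁺ = ∈-setOf⁺ (λ v → v ∈? X ×-dec c v ≟ _)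
    ∈⁻ : ∀ {i v} → v ∈ colourClass X c i → v ∈ X × c v ≡ i
    ∈⁻ = ∈-setOf⁻ (λ v → v ∈? X ×-dec c v ≟ _)
    nonempty : ∀ i → Nonempty (colourClass X c i)
    nonempty i with surjective i
    ... | v , v∈X×cv≡i = v , ∈⁺ v∈X×cv≡i
    disjoint : ∀ i j → i ≢ j → ∀ v → v ∈ colourClass X c i → v ∉ colourClass X c j
    disjoint i j i≢j v v∈ᵢ v∈ⱼ = i≢j (trans (sym (proj₂ (∈⁻ v∈ᵢ))) (proj₂ (∈⁻ v∈ⱼ)))
    covered : ∀ {v} → v ∈ X → ∃[ i ] (v ∈ colourClass X c i)
    covered v∈X = _ , ∈⁺ (v∈X , refl)
    dominates : ∀ i v → v ∉ X → InOutNbhd D (colourClass X c i) v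
    dominates i v v∉X with dominated i v v∉X
    ... | u , u∈X , cu≡i , u→v = u , ∈⁺ (u∈X , cu≡i) , u→v

  support-goodPartition : .{{_ : NonZero k}} → k ≤ n → ∀ {f} → IsKRDF D k f →
    (∀ v → ∣ f v ∣ ≤ 1) → ∃[ Xs ] GoodPartition D k (support f) Xs
  support-goodPartition k≤n {f} f-kRDF ∣f∣≤1 with any? (λ v → ¬? (v ∈? support f))
  ... | yes (w , w∉X) =
    colourClass (support f) (pick ∘ f) , colourClasses-good (support f) (pick ∘ f) surjective dominated
    where
    dominated : ∀ i v → v ∉ support f → ∃[ u ] (u ∈ support f × pick (f u) ≡ i × Arc D u v)
    dominated i v v∉X with f-kRDF v (Empty-unique (v∉X ∘ ∈-support⁺)) i
    ... | u , u→v , i∈fu = u , ∈-support⁺ (i , i∈fu) , pick-unique (∣f∣≤1 u) i∈fu , u→v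
    surjective : ∀ i → ∃[ u ] (u ∈ support f × pick (f u) ≡ i)
    surjective i with dominated i w w∉X
    ... | u , u∈X , fu≡i , _ = u , u∈X , fu≡i
  ... | no ∄v∉X =
    colourClass (support f) residue ,
    colourClasses-good (support f) residue surjective (λ i v v∉X → contradiction (v , v∉X) ∄v∉X)
    where
    residue : Fin n → Fin k
    residue v = toℕ v mod k
    ∈X : ∀ v → v ∈ support f
    ∈X v with v ∈? support f
    ... | yes v∈X = v∈X
    ... | no v∉X  = contradiction (v , v∉X) ∄v∉X
    surjective : ∀ i → ∃[ v ] (v ∈ support f × residue v ≡ i)
    surjective i = inject≤ i k≤n , ∈X _ , trans (cong (_mod k) (toℕ-inject≤ i k≤n)) (toℕ-mod i)

  module _ .{{_ : NonZero k}} where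

    ∣γt-set∣≤weight : ∀ {S f} → IsGammaTSet D S → IsTKRDF D k f → ∣ S ∣ ≤ weight D k f
    ∣γt-set∣≤weight {f = f} (_ , S-min) f-tk = ≤-trans (S-min _ (support-isTDS f-tk)) (∣support∣≤weight f)

    γtrk-weight≤k*∣tds∣ : ∀ {f S} → IsGammaTRkFunction D k f → IsTDS D S → weight D k f ≤ k * ∣ S ∣
    γtrk-weight≤k*∣tds∣ {S = S} (_ , f-min) S-tds =
      ≤-trans (f-min _ (fullOn-isTKRDF S-tds)) (≤-reflexive (weight-fullOn S))

    k*∣γt-set∣≤weight-⊤⊥ : ∀ {S f} → IsGammaTSet D S → IsTKRDF D k f →
      (∀ v → f v ≡ ⊤ ⊎ f v ≡ ⊥) → k * ∣ S ∣ ≤ weight D k f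
    k*∣γt-set∣≤weight-⊤⊥ {S} {f} (_ , S-min) f-tk ⊤⊥-valued = begin
      k * ∣ S ∣                        ≤⟨ *-monoʳ-≤ k (S-min _ (support-isTDS f-tk)) ⟩
      k * ∣ support f ∣                ≡⟨ weight-fullOn (support f) ⟨
      weight D k (fullOn (support f))  ≡⟨ cong sum (tabulate-cong (cong ∣_∣ ∘ ⊤⊥-valued⇒≗fullOn-support ⊤⊥-valued)) ⟨
      weight D k f                     ∎
      where open ≤-Reasoning

    γt-weight⇒goodPartition : k ≤ n → ∀ {S f} → IsGammaTSet D S → IsTKRDF D k f → weight D k f ≤ ∣ S ∣ →
      ∃[ X ] (IsGammaTSet D X × ∃[ Xs ] GoodPartition D k X Xs)
    γt-weight⇒goodPartition k≤n {S} {f} (_ , S-min) f-tk@(f-kRDF , _) wf≤∣S∣ =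
      support f , (support-isTDS f-tk , X-min) ,
      support-goodPartition k≤n f-kRDF (weight≤∣support∣⇒∣f∣≤1 (≤-trans wf≤∣S∣ (S-min _ (support-isTDS f-tk))))
      where
      X-min : ∀ T → IsTDS D T → ∣ support f ∣ ≤ ∣ T ∣
      X-min T T-tds = ≤-trans (∣support∣≤weight f) (≤-trans wf≤∣S∣ (S-min T T-tds))

  weight≤∣partitioned-tds∣ : ∀ {f X Xs} → IsGammaTRkFunction D k f → IsTDS D X →
    GoodPartition D k X Xs → weight D k f ≤ ∣ X ∣
  weight≤∣partitioned-tds∣ (_ , f-min) X-tds partition =
    ≤-trans (f-min _ (blocksContaining-isTKRDF partition X-tds)) (weight-blocksContaining partition)

  isGammaTRk-by-weight : ∀ {f h} → IsGammaTRkFunction D k f → IsTKRDF D k h →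
    weight D k h ≤ weight D k f → IsGammaTRkFunction D k h
  isGammaTRk-by-weight (_ , f-min) h-tk wh≤wf = h-tk , λ g g-tk → ≤-trans wh≤wf (f-min g g-tk)

theorem2p2 : (k n : ℕ) → 1 ≤ k → n ≥ k → (D : Digraph n) → NoIsolatedVertex D →
    (g t : ℕ) → IsGammaT D g → IsGammaTRk D k t →
    (g ≤ t × t ≤ k * g)
    × ((g ≡ t) ⇔ (∃[ X ] (IsGammaTSet D X × ∃[ Xs ] GoodPartition D k X Xs)))
    × ((t ≡ k * g) ⇔ (∃[ f ] (IsGammaTRkFunction D k f × (∀ v → f v ≡ ⊤ ⊎ f v ≡ ⊥))))
theorem2p2 k n 1≤k k≤n D _ _ _ (S , S-γ@(S-tds , _) , refl) (f , f-γ@(f-tk , _) , refl) =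
  (g≤t , t≤kg) ,
  mk⇔ (λ g≡t → γt-weight⇒goodPartition D k≤n S-γ f-tk (≤-reflexive (sym g≡t)))
      (λ (X , (X-tds , X-min) , _ , partition) →
        ≤-antisym g≤t (≤-trans (weight≤∣partitioned-tds∣ D f-γ X-tds partition) (X-min S S-tds))) ,
  mk⇔ (λ t≡kg → fullOn D S ,
        isGammaTRk-by-weight D f-γ (fullOn-isTKRDF D S-tds)
          (≤-reflexive (trans (weight-fullOn D S) (sym t≡kg))) ,
        fullOn-⊤⊥-valued D S)
      (λ (h , (h-tk , h-min) , ⊤⊥-valued) →
        ≤-antisym t≤kg (≤-trans (k*∣γt-set∣≤weight-⊤⊥ D S-γ h-tk ⊤⊥-valued) (h-min f f-tk)))
  where
  instance
    k≢0 : NonZero k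
    k≢0 = >-nonZero 1≤k
  g≤t : ∣ S ∣ ≤ weight D k f
  g≤t = ∣γt-set∣≤weight D S-γ f-tk
  t≤kg : weight D k f ≤ k * ∣ S ∣
  t≤kg = γtrk-weight≤k*∣tds∣ D f-γ S-tds
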